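{- Let $G$ be a connected chordal graph and let $r=r_0,\dots,r_{|r|-1}$ be a separator path in $G$. For all $0\le i<j<|r|$, the vertices $r_i$ and $r_j$ are strongly $r$-connected if and only if $j-i=2$.
   Context: A chordal graph is a simple undirected graph in which every cycle with four or more vertices has a chord. A path is a sequence of vertices with consecutive vertices adjacent; it is simple if its vertices are distinct; $p_{i,j}$ is the subpath $p_i,\dots,p_j$ and $p$ contains $q$ if $q=p_{i,j}$ for some $i\le j$. A path is separating if removing all its edges disconnects $G$. A separator path is a simple separating path not containing any separating path other than itself. For a simple path $p$, two vertices $u,v$ are strongly $p$-connected if there is a path $p'$ between $u$ and $v$ that shares no edge with $p$ and, except at its endpoints, shares no vertex with $p$. -}

module Defs where

open import Data.Nat using (ℕ; zero; suc; _+_; _∸_; _≤_; _<_)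
open import Data.Fin using (Fin; toℕ)
open import Data.Bool using (Bool; true; false)
open import Data.List using (List; []; _∷_; _++_; length; lookup)
open import Data.List.Relation.Unary.All using (All)
open import Data.List.Relation.Unary.Unique.Propositional using (Unique)
open import Data.List.Membership.Propositional using (_∉_)
open import Data.Product using (Σ; _×_; ∃; ∃₂; _,_)
open import Data.Sum using (_⊎_)
open import Data.Empty using (⊥)
open import Data.Unit using (⊤)
open import Relation.Nullary using (¬_)
open import Relation.Binary.PropositionalEquality using (_≡_; _≢_)
open import Relation.Binary.Construct.Closure.ReflexiveTransitive using (Star)

record Graph : Set where
  field
    n      : ℕ
    adj    : Fin n → Fin n → Bool
    sym    : ∀ u v → adj u v ≡ adj v u
    irrefl : ∀ u → adj u u ≡ false

module _ (G : Graph) where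
  open Graph G

  V : Set
  V = Fin n

  Adj : V → V → Set
  Adj u v = adj u v ≡ true

  IsWalkIn : (V → V → Set) → List V → Set
  IsWalkIn R []           = ⊥
  IsWalkIn R (x ∷ [])     = ⊤
  IsWalkIn R (x ∷ y ∷ xs) = R x y × IsWalkIn R (y ∷ xs)

  IsPath : List V → Set
  IsPath = IsWalkIn Adj

  IsSimplePath : List V → Set
  IsSimplePath p = IsPath p × Unique p

  EdgeOf : List V → V → V → Set
  EdgeOf []           u v = ⊥
  EdgeOf (x ∷ [])     u v = ⊥
  EdgeOf (x ∷ y ∷ xs) u v =
    ((x ≡ u × y ≡ v) ⊎ (x ≡ v × y ≡ u)) ⊎ EdgeOf (y ∷ xs) u v

  AdjMinus : List V → V → V → Set
  AdjMinus p u v = Adj u v × ¬ EdgeOf p u v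

  Connected : Set
  Connected = ∀ u v → Star Adj u v

  IsSeparating : List V → Set
  IsSeparating p = IsPath p × ¬ (∀ u v → Star (AdjMinus p) u v)

  Contains : List V → List V → Set
  Contains p q = q ≢ [] × ∃₂ λ xs ys → p ≡ xs ++ q ++ ys

  IsSeparatorPath : List V → Set
  IsSeparatorPath p =
    IsSimplePath p × IsSeparating p ×
    (∀ q → Contains p q → IsSeparating q → q ≡ p)

  StronglyConnected : List V → V → V → Set
  StronglyConnected p u v =
    ∃ λ inner → IsWalkIn (AdjMinus p) (u ∷ inner ++ v ∷ []) × All (_∉ p) inner

  -- a cycle c₀ … c_{k-1} (k ≥ 4 distinct vertices, c_{k-1} adjacent to c₀)

  Chordal : Set
  Chordal = ∀ (c : List V) → IsPath c → Unique c → 4 ≤ length c →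
    (∀ (f l : Fin (length c)) → toℕ f ≡ 0 → suc (toℕ l) ≡ length c →
        Adj (lookup c f) (lookup c l)) →
    ∃₂ λ (a b : Fin (length c)) →
      2 + toℕ a ≤ toℕ b × ¬ (toℕ a ≡ 0 × suc (toℕ b) ≡ length c) ×
      Adj (lookup c a) (lookup c b)

-- Write H for G without the edges of r, and ~ for connectivity in H. The key fact uses
-- chordality: if v is adjacent to x and y, and an x–y path avoids v and its neighbours
-- apart from x and y, then x = y or xy is an edge (a shortest such path closes a
-- chordless cycle through v). Minimality of r means that r without its first (or last)
-- edge does not separate G, so every vertex reaches an end of that edge in H. Hence H
-- has two components, and by induction along r consecutive vertices of r lie in
-- different ones; the key fact then yields the chords r_k r_{k+2}. A strong r_i–r_j path
-- is a walk in H, which excludes j = i+1. For j ≥ i+3, continue it backwards along r to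
-- the last neighbour r_t of r_{i+1}: the key fact gives edges r_i r_t and r_{i+1} r_t
-- outside r, which would join r_i and r_{i+1} in H.
module Submission where

open import Defs
open import Data.Bool as Bool using (true)
open import Data.Empty using (⊥; ⊥-elim)
open import Data.Fin using (Fin; toℕ; zero; suc)
open import Data.Fin.Properties using (toℕ<n)
import Data.Fin as Fin
open import Data.List using (List; []; _∷_; _++_; length; lookup)
open import Data.List.Membership.Propositional using (_∈_; _∉_)
open import Data.List.Membership.Propositional.Properties using (∈-∃++; ∈-insert; ∈-++⁺ˡ; ∈-length)
open import Data.List.Properties using (length-++; ++-assoc; ++-identityʳ; length-++-≤ʳ; ∷-injectiveˡ; ∷-injectiveʳ)
open import Data.List.Relation.Binary.Subset.Propositional using (_⊆_)
open import Data.List.Relation.Binary.Subset.Propositional.Properties using (++⁺ʳ; xs⊆ys++xs)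
open import Data.List.Relation.Unary.All as All using (All; []; _∷_)
open import Data.List.Relation.Unary.All.Properties using (¬Any⇒All¬; anti-mono) renaming (++⁺ to All-++⁺)
open import Data.List.Relation.Unary.Any using (here; there)
open import Data.List.Relation.Unary.Unique.Propositional using (Unique)
open import Data.List.Relation.Unary.AllPairs using ([]; _∷_)
open import Data.Nat using (ℕ; zero; suc; _+_; _<_; _≤_; z≤n; s≤s; _≟_)
open import Data.Nat.Induction using (Acc; acc; <-wellFounded)
open import Data.Nat.Properties using (+-identityʳ; +-suc; +-comm; suc-injective; <⇒≤; ≤-refl; ≤-trans; <-≤-trans; ≤-<-trans; <-trans; n≤1+n; m≤n+m; 1+n≰n; >⇒≢; m≤n⇒m<n∨m≡n; ≤-pred; ≤-antisym; <-cmp)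
open import Data.Product using (Σ; ∃; ∃₂; _×_; _,_; proj₁)
open import Function using (_∘_)
open import Function.Bundles using (_⇔_; mk⇔)
open import Relation.Binary.Definitions using (DecidableEquality; tri<; tri≈; tri>)
open import Data.Sum as Sum using (_⊎_; inj₁; inj₂)
open import Relation.Binary.PropositionalEquality using (_≡_; _≢_; refl; sym; trans; cong; subst; subst₂)
open import Relation.Nullary using (¬_; Dec; yes; no)
open import Relation.Nullary.Decidable using (_×-dec_; _⊎-dec_; decidable-stable)
open import Relation.Binary.Construct.Closure.ReflexiveTransitive as Star using (Star; ε; _◅_; _◅◅_)

module _ {A : Set} where

  data Head (x : A) : List A → Set where
    head : ∀ {xs} → Head x (x ∷ xs)

  data Last (y : A) : List A → Set where
    [-] : Last y (y ∷ [])
    _∷_ : ∀ x {xs} → Last y xs → Last y (x ∷ xs)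

  infixr 5 _∷_

  Head-++⁺ˡ : ∀ {x xs ys} → Head x xs → Head x (xs ++ ys)
  Head-++⁺ˡ head = head

  Head-cut : ∀ {x} pre {u ys zs} → Head x (pre ++ u ∷ ys) → Head x (pre ++ u ∷ zs)
  Head-cut []      head = head
  Head-cut (_ ∷ _) head = head

  Last-++ : ∀ {y} xs {ys} → Last y ys → Last y (xs ++ ys)
  Last-++ []       ℓ = ℓ
  Last-++ (x ∷ xs) ℓ = x ∷ Last-++ xs ℓ

  Last-suffix : ∀ {y} xs {u ys} → Last y (xs ++ u ∷ ys) → Last y (u ∷ ys)
  Last-suffix []           ℓ       = ℓ
  Last-suffix (_ ∷ [])     (_ ∷ ℓ) = ℓ
  Last-suffix (_ ∷ x ∷ xs) (_ ∷ ℓ) = Last-suffix (x ∷ xs) ℓ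

  Last⇒∈ : ∀ {y xs} → Last y xs → y ∈ xs
  Last⇒∈ [-]     = here refl
  Last⇒∈ (_ ∷ ℓ) = there (Last⇒∈ ℓ)

  lookup-Last : ∀ {y xs} → Last y xs → (l : Fin (length xs)) → suc (toℕ l) ≡ length xs → lookup xs l ≡ y
  lookup-Last [-]         zero    _  = refl
  lookup-Last (_ ∷ [-])   zero    ()
  lookup-Last (_ ∷ _ ∷ ℓ) zero    ()
  lookup-Last (_ ∷ ℓ)     (suc l) eq = lookup-Last ℓ l (suc-injective eq)

  -- Indices at or beyond the end return the default d.
  nth : A → List A → ℕ → A
  nth d []       _       = d
  nth d (x ∷ xs) zero    = x
  nth d (x ∷ xs) (suc k) = nth d xs k

  lookup≡nth : ∀ d xs (i : Fin (length xs)) → lookup xs i ≡ nth d xs (toℕ i)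
  lookup≡nth d (x ∷ xs) zero    = refl
  lookup≡nth d (x ∷ xs) (suc i) = lookup≡nth d xs i

  nth-∈ : ∀ d xs {k} → k < length xs → nth d xs k ∈ xs
  nth-∈ d (x ∷ xs) {zero}  _         = here refl
  nth-∈ d (x ∷ xs) {suc k} (s≤s k<) = there (nth-∈ d xs k<)

  nth-++ : ∀ d xs {ys} k → nth d (xs ++ ys) (k + length xs) ≡ nth d ys k
  nth-++ d []       k rewrite +-identityʳ k = refl
  nth-++ d (x ∷ xs) k rewrite +-suc k (length xs) = nth-++ d xs k

  nth-injective : ∀ d {xs} → Unique xs → ∀ {k l} → k < length xs → l < length xs →
                  nth d xs k ≡ nth d xs l → k ≡ l
  nth-injective d {x ∷ xs} (_ ∷ u)  {zero}  {zero}  _        _        _  = refl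
  nth-injective d {x ∷ xs} (x∉ ∷ u) {zero}  {suc l} _        (s≤s l<) eq = ⊥-elim (All.lookup x∉ (nth-∈ d xs l<) eq)
  nth-injective d {x ∷ xs} (x∉ ∷ u) {suc k} {zero}  (s≤s k<) _        eq = ⊥-elim (All.lookup x∉ (nth-∈ d xs k<) (sym eq))
  nth-injective d {x ∷ xs} (_ ∷ u)  {suc k} {suc l} (s≤s k<) (s≤s l<) eq = cong suc (nth-injective d u k< l< eq)

  length-++-< : ∀ xs {ys zs : List A} → length ys < length zs → length (xs ++ ys) < length (xs ++ zs)
  length-++-< []       lt = lt
  length-++-< (_ ∷ xs) lt = s≤s (length-++-< xs lt)

  ∉-later : ∀ xs {u : A} {ys} → Unique (xs ++ u ∷ ys) → u ∉ ys
  ∉-later []       (u∉ ∷ _) u∈ = All.lookup u∉ u∈ refl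
  ∉-later (_ ∷ xs) (_ ∷ u)     = ∉-later xs u

  lookup-split : ∀ xs (j : Fin (length xs)) →
    ∃₂ λ (pre post : List A) → xs ≡ pre ++ lookup xs j ∷ post × length pre ≡ toℕ j × length xs ≡ suc (toℕ j) + length post
  lookup-split (x ∷ xs) zero    = [] , xs , refl , refl , refl
  lookup-split (x ∷ xs) (suc j) with lookup-split xs j
  ... | pre , post , eq , |pre| , |xs| = x ∷ pre , post , cong (x ∷_) eq , cong suc |pre| , cong suc |xs|

  lookup-split₂ : ∀ xs (i j : Fin (length xs)) → toℕ i < toℕ j →
    Σ (List A) λ pre → ∃₂ λ (mid post : List A) →
      xs ≡ pre ++ lookup xs i ∷ mid ++ lookup xs j ∷ post ×
      length pre ≡ toℕ i × toℕ j ≡ toℕ i + suc (length mid) × length xs ≡ suc (toℕ j) + length post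
  lookup-split₂ (x ∷ xs) zero    (suc j) _ with lookup-split xs j
  ... | mid , post , eq , |mid| , |xs| = [] , mid , post , cong (x ∷_) eq , refl , cong suc (sym |mid|) , cong suc |xs|
  lookup-split₂ (x ∷ xs) (suc i) (suc j) (s≤s i<j) with lookup-split₂ xs i j i<j
  ... | pre , mid , post , eq , |pre| , j≡ , |xs| =
    x ∷ pre , mid , post , cong (x ∷_) eq , cong suc |pre| , cong suc j≡ , cong suc |xs|

  module _ (_≟_ : DecidableEquality A) where
    open import Data.List.Membership.DecPropositional _≟_ using (_∈?_)

    unique-or-repeat : ∀ xs → Unique xs ⊎ (Σ (List A) λ pre → Σ A λ u → ∃₂ λ (mid post : List A) → xs ≡ pre ++ u ∷ mid ++ u ∷ post)
    unique-or-repeat []       = inj₁ []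
    unique-or-repeat (x ∷ xs) with x ∈? xs
    ... | yes x∈ with ∈-∃++ x∈
    ...   | mid , post , eq = inj₂ ([] , x , mid , post , cong (x ∷_) eq)
    unique-or-repeat (x ∷ xs) | no x∉ with unique-or-repeat xs
    ...   | inj₁ u = inj₁ (¬Any⇒All¬ xs x∉ ∷ u)
    ...   | inj₂ (pre , u , mid , post , eq) = inj₂ (x ∷ pre , u , mid , post , cong (x ∷_) eq)

  split-last-two : ∀ (x y : A) zs → Σ (List A) λ init → ∃₂ λ (z y′ : A) → x ∷ y ∷ zs ≡ init ++ z ∷ y′ ∷ []
  split-last-two x y []       = [] , x , y , refl
  split-last-two x y (z ∷ zs) with split-last-two y z zs
  ... | init , z′ , y′ , eq = x ∷ init , z′ , y′ , cong (x ∷_) eq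

module TwoEnds {A : Set} {R : A → A → Set} (R-sym : ∀ {u v} → R u v → R v u)
               {e₁ e₂ : A} (reach : ∀ u → Star R e₁ u ⊎ Star R e₂ u) where

  ~-sym : ∀ {u v} → Star R u v → Star R v u
  ~-sym = Star.reverse R-sym

  connected-if-ends-connected : Star R e₁ e₂ → ∀ u v → Star R u v
  connected-if-ends-connected e₁~e₂ u v with reach u | reach v
  ... | inj₁ p | inj₁ q = ~-sym p ◅◅ q
  ... | inj₁ p | inj₂ q = ~-sym p ◅◅ e₁~e₂ ◅◅ q
  ... | inj₂ p | inj₁ q = ~-sym p ◅◅ ~-sym e₁~e₂ ◅◅ q
  ... | inj₂ p | inj₂ q = ~-sym p ◅◅ q

  module _ (e₁≁e₂ : ¬ Star R e₁ e₂) where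

    connected? : ∀ u v → Dec (Star R u v)
    connected? u v with reach u | reach v
    ... | inj₁ p | inj₁ q = yes (~-sym p ◅◅ q)
    ... | inj₂ p | inj₂ q = yes (~-sym p ◅◅ q)
    ... | inj₁ p | inj₂ q = no λ u~v → e₁≁e₂ (p ◅◅ u~v ◅◅ ~-sym q)
    ... | inj₂ p | inj₁ q = no λ u~v → e₁≁e₂ (q ◅◅ ~-sym u~v ◅◅ ~-sym p)

    both-≁⇒~ : ∀ {u v w} → ¬ Star R u w → ¬ Star R v w → Star R u v
    both-≁⇒~ {u} {v} {w} u≁w v≁w with reach u | reach v | reach w
    ... | inj₁ p | inj₁ q | _      = ~-sym p ◅◅ q
    ... | inj₂ p | inj₂ q | _      = ~-sym p ◅◅ q
    ... | inj₁ p | inj₂ _ | inj₁ s = ⊥-elim (u≁w (~-sym p ◅◅ s))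
    ... | inj₁ _ | inj₂ q | inj₂ s = ⊥-elim (v≁w (~-sym q ◅◅ s))
    ... | inj₂ _ | inj₁ q | inj₁ s = ⊥-elim (v≁w (~-sym q ◅◅ s))
    ... | inj₂ p | inj₁ _ | inj₂ s = ⊥-elim (u≁w (~-sym p ◅◅ s))

module _ (G : Graph) where

  Adj-sym : ∀ {u v} → Adj G u v → Adj G v u
  Adj-sym {u} {v} uv = trans (Graph.sym G v u) uv

  Adj-irreflexive : ∀ {u} → ¬ Adj G u u
  Adj-irreflexive {u} uu with trans (sym uu) (Graph.irrefl G u)
  ... | ()

  Adj? : ∀ u v → Dec (Adj G u v)
  Adj? u v = Graph.adj G u v Bool.≟ true

  record WalkBetween (R : V G → V G → Set) (x y : V G) (ws : List (V G)) : Set where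
    field
      walk   : IsWalkIn G R ws
      starts : Head x ws
      ends   : Last y ws

  PathBetween : V G → V G → List (V G) → Set
  PathBetween = WalkBetween (Adj G)

  module _ {R : V G → V G → Set} where

    walk-prefix : ∀ xs {u ys} → IsWalkIn G R (xs ++ u ∷ ys) → IsWalkIn G R (xs ++ u ∷ [])
    walk-prefix []           _        = _
    walk-prefix (_ ∷ [])     (r , _)  = r , _
    walk-prefix (_ ∷ x ∷ xs) (r , w)  = r , walk-prefix (x ∷ xs) w

    walk-suffix : ∀ xs {u ys} → IsWalkIn G R (xs ++ u ∷ ys) → IsWalkIn G R (u ∷ ys)
    walk-suffix []           w       = w
    walk-suffix (_ ∷ [])     (_ , w) = w
    walk-suffix (_ ∷ x ∷ xs) (_ , w) = walk-suffix (x ∷ xs) w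

    walk-join : ∀ xs {u ys} → IsWalkIn G R (xs ++ u ∷ []) → IsWalkIn G R (u ∷ ys) → IsWalkIn G R (xs ++ u ∷ ys)
    walk-join []           _       w = w
    walk-join (_ ∷ [])     (r , _) w = r , w
    walk-join (_ ∷ x ∷ xs) (r , v) w = r , walk-join (x ∷ xs) v w

    walk-snoc : ∀ {u w xs} → IsWalkIn G R xs → Last u xs → R u w → IsWalkIn G R (xs ++ w ∷ [])
    walk-snoc _       [-]         r = r , _
    walk-snoc {xs = _ ∷ _ ∷ _} (s , v) (_ ∷ ℓ) r = s , walk-snoc v ℓ r

    walk-step : ∀ d xs {k} → IsWalkIn G R xs → suc k < length xs → R (nth d xs k) (nth d xs (suc k))
    walk-step d (x ∷ y ∷ xs) {zero}  (r , _) _         = r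
    walk-step d (x ∷ y ∷ xs) {suc k} (_ , w) (s≤s k<) = walk-step d (y ∷ xs) w k<
    walk-step d (x ∷ [])     _       (s≤s ())

    walk-reach : ∀ {x y ws w} → WalkBetween R x y ws → w ∈ ws → Star R x w
    walk-reach record { starts = head } (here refl) = ε
    walk-reach {ws = _ ∷ _ ∷ _} record { walk = r , w ; starts = head ; ends = _ ∷ ℓ } (there w∈) =
      r ◅ walk-reach record { walk = w ; starts = head ; ends = ℓ } w∈

    star⇒walk : ∀ {x y} → Star R x y → ∃ (WalkBetween R x y)
    star⇒walk {x} ε = x ∷ [] , record { walk = _ ; starts = head ; ends = [-] }
    star⇒walk {x} (r ◅ s) with star⇒walk s
    ... | ws , record { walk = w ; starts = head ; ends = ℓ } =
      x ∷ ws , record { walk = r , w ; starts = head ; ends = x ∷ ℓ }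

  walk-map : ∀ {R R′ : V G → V G → Set} → (∀ {u v} → R u v → R′ u v) → ∀ xs → IsWalkIn G R xs → IsWalkIn G R′ xs
  walk-map f (_ ∷ [])     _       = _
  walk-map f (_ ∷ y ∷ xs) (r , w) = f r , walk-map f (y ∷ xs) w

  EdgeOf-sym : ∀ xs {a b} → EdgeOf G xs a b → EdgeOf G xs b a
  EdgeOf-sym (_ ∷ _ ∷ _)  (inj₁ e) = inj₁ (Sum.swap e)
  EdgeOf-sym (_ ∷ y ∷ xs) (inj₂ e) = inj₂ (EdgeOf-sym (y ∷ xs) e)

  EdgeOf? : ∀ xs a b → Dec (EdgeOf G xs a b)
  EdgeOf? []           a b = no λ ()
  EdgeOf? (_ ∷ [])     a b = no λ ()
  EdgeOf? (x ∷ y ∷ xs) a b =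
    ((x Fin.≟ a ×-dec y Fin.≟ b) ⊎-dec (x Fin.≟ b ×-dec y Fin.≟ a)) ⊎-dec EdgeOf? (y ∷ xs) a b

  EdgeOf⇒consecutive : ∀ d xs {a b} → EdgeOf G xs a b → ∃ λ k → suc k < length xs ×
    ((nth d xs k ≡ a × nth d xs (suc k) ≡ b) ⊎ (nth d xs k ≡ b × nth d xs (suc k) ≡ a))
  EdgeOf⇒consecutive d (_ ∷ _ ∷ _)  (inj₁ e) = 0 , s≤s (s≤s z≤n) , e
  EdgeOf⇒consecutive d (_ ∷ y ∷ xs) (inj₂ e) with EdgeOf⇒consecutive d (y ∷ xs) e
  ... | k , k< , e′ = suc k , s≤s k< , e′

  EdgeOf-split : ∀ xs {z ys a b} → EdgeOf G (xs ++ z ∷ ys) a b → EdgeOf G (xs ++ z ∷ []) a b ⊎ EdgeOf G (z ∷ ys) a b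
  EdgeOf-split []           e        = inj₂ e
  EdgeOf-split (_ ∷ [])     (inj₁ e) = inj₁ (inj₁ e)
  EdgeOf-split (_ ∷ [])     (inj₂ e) = inj₂ e
  EdgeOf-split (_ ∷ x ∷ xs) (inj₁ e) = inj₁ (inj₁ e)
  EdgeOf-split (_ ∷ x ∷ xs) (inj₂ e) = Sum.map₁ inj₂ (EdgeOf-split (x ∷ xs) e)

  AdjMinus-sym : ∀ p {u v} → AdjMinus G p u v → AdjMinus G p v u
  AdjMinus-sym p (uv , ¬e) = Adj-sym uv , λ e → ¬e (EdgeOf-sym p e)

  -- Follow the walk, restarting from e₁ or e₂ whenever it enters one of them: the only
  -- edge of r it may use ends there.
  reach-either-end : ∀ {r p e₁ e₂} →
    (∀ {a b} → EdgeOf G r a b → EdgeOf G p a b ⊎ EdgeOf G (e₁ ∷ e₂ ∷ []) a b) →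
    ∀ {u} → Star (AdjMinus G p) e₁ u → Star (AdjMinus G r) e₁ u ⊎ Star (AdjMinus G r) e₂ u
  reach-either-end {r} {p} {e₁} {e₂} r⊆p+e = go (inj₁ ε)
    where
      Reached : V G → Set
      Reached w = Star (AdjMinus G r) e₁ w ⊎ Star (AdjMinus G r) e₂ w

      go : ∀ {w u} → Reached w → Star (AdjMinus G p) w u → Reached u
      go reached ε = reached
      go {w} reached (_◅_ {j = t} (wt , ¬p-edge) s) with t Fin.≟ e₁ | t Fin.≟ e₂
      ... | yes refl | _        = go (inj₁ ε) s
      ... | no _     | yes refl = go (inj₂ ε) s
      ... | no t≢e₁  | no t≢e₂  = go (Sum.map (_◅◅ (wt , ¬r-edge) ◅ ε) (_◅◅ (wt , ¬r-edge) ◅ ε) reached) s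
        where
          ¬r-edge : ¬ EdgeOf G r w t
          ¬r-edge e with r⊆p+e e
          ... | inj₁ p-edge                  = ¬p-edge p-edge
          ... | inj₂ (inj₁ (inj₁ (_ , refl))) = t≢e₂ refl
          ... | inj₂ (inj₁ (inj₂ (refl , _))) = t≢e₁ refl


  NonNbr : V G → V G → Set
  NonNbr v w = w ≢ v × ¬ Adj G v w

  Clear : V G → V G → V G → V G → Set
  Clear v x y w = w ≡ x ⊎ w ≡ y ⊎ NonNbr v w

  Detour : V G → V G → V G → List (V G) → Set
  Detour v x y ws = PathBetween x y ws × All (Clear v x y) ws

  record Shortcut (x y : V G) (ws : List (V G)) : Set where
    field
      path    : List (V G)
      between : PathBetween x y path
      ⊆ws     : path ⊆ ws
      shorter : length path < length ws

  shortcut-repeat : ∀ {x y} pre u mid post →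
    PathBetween x y (pre ++ u ∷ mid ++ u ∷ post) → Shortcut x y (pre ++ u ∷ mid ++ u ∷ post)
  shortcut-repeat pre u mid post record { walk = w ; starts = h ; ends = ℓ } = record
    { path    = pre ++ u ∷ post
    ; between = record
      { walk   = walk-join pre (walk-prefix pre w) (walk-suffix (u ∷ mid) (walk-suffix pre w))
      ; starts = Head-cut pre h
      ; ends   = Last-++ pre (Last-suffix (u ∷ mid) (Last-suffix pre ℓ))
      }
    ; ⊆ws     = ++⁺ʳ pre (xs⊆ys++xs (u ∷ post) (u ∷ mid))
    ; shorter = length-++-< pre (s≤s (length-++-≤ʳ (u ∷ post) {mid}))
    }

  shortcut-chord : ∀ {x y} pre p m ms q post → Adj G p q →
    PathBetween x y (pre ++ p ∷ (m ∷ ms) ++ q ∷ post) → Shortcut x y (pre ++ p ∷ (m ∷ ms) ++ q ∷ post)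
  shortcut-chord pre p m ms q post pq record { walk = w ; starts = h ; ends = ℓ } = record
    { path    = pre ++ p ∷ q ∷ post
    ; between = record
      { walk   = walk-join pre (walk-prefix pre w) (pq , walk-suffix (p ∷ m ∷ ms) (walk-suffix pre w))
      ; starts = Head-cut pre h
      ; ends   = Last-++ pre (p ∷ Last-suffix (p ∷ m ∷ ms) (Last-suffix pre ℓ))
      }
    ; ⊆ws     = ++⁺ʳ pre (++⁺ʳ (p ∷ []) (xs⊆ys++xs (q ∷ post) (m ∷ ms)))
    ; shorter = length-++-< pre (s≤s (s≤s (length-++-≤ʳ (q ∷ post) {ms})))
    }

  detour-shortcut : ∀ {v x y ws} → Detour v x y ws → (s : Shortcut x y ws) → Detour v x y (Shortcut.path s)
  detour-shortcut (_ , clear) s = Shortcut.between s , anti-mono (Shortcut.⊆ws s) clear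

  detour-snoc : ∀ {v x y z ws} → Detour v x y ws → Adj G y z → NonNbr v y → Detour v x z (ws ++ z ∷ [])
  detour-snoc {ws = ws} (record { walk = w ; starts = h ; ends = ℓ } , clear) yz y-off = record
    { walk   = walk-snoc w ℓ yz
    ; starts = Head-++⁺ˡ h
    ; ends   = Last-++ ws [-]
    } , All-++⁺ (All.map relabel clear) (inj₂ (inj₁ refl) ∷ [])
    where
      relabel : ∀ {w} → Clear _ _ _ w → Clear _ _ _ w
      relabel (inj₁ w≡x)          = inj₁ w≡x
      relabel (inj₂ (inj₁ refl))  = inj₂ (inj₂ y-off)
      relabel (inj₂ (inj₂ w-off)) = inj₂ (inj₂ w-off)

  Clear⇒≢ : ∀ {v x y w} → Adj G v x → Adj G v y → Clear v x y w → v ≢ w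
  Clear⇒≢ v-x _   (inj₁ refl)              refl = Adj-irreflexive v-x
  Clear⇒≢ _   v-y (inj₂ (inj₁ refl))       refl = Adj-irreflexive v-y
  Clear⇒≢ _   _   (inj₂ (inj₂ (w≢v , _))) v≡w  = w≢v (sym v≡w)

  interior-not-adjacent : ∀ {v x y ws m} ms {q} o os → ws ≡ m ∷ ms ++ q ∷ o ∷ os →
    PathBetween x y ws → Unique ws → All (Clear v x y) ws → ¬ Adj G v q
  interior-not-adjacent ms o os refl record { starts = head ; ends = ℓ } (x∉ ∷ u) clear v-q
    with All.lookup clear (∈-insert (_ ∷ ms))
  ... | inj₁ refl              = All.lookup x∉ (∈-insert ms) refl
  ... | inj₂ (inj₁ refl)       = ∉-later ms u y∈
    where
      y∈ : _ ∈ o ∷ os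
      y∈ with Last-suffix (_ ∷ ms) ℓ
      ... | _ ∷ ℓ′ = Last⇒∈ ℓ′
  ... | inj₂ (inj₂ (_ , ¬v-q)) = ¬v-q v-q

  module _ (chordal : Chordal G) where

    -- The cycle v ∷ ws has a chord; it cannot meet v, so it shortcuts ws.
    chord-shortcut : ∀ {v x y ws} → Adj G v x → Adj G v y → Detour v x y ws → Unique ws → 3 ≤ length ws →
                     Shortcut x y ws
    chord-shortcut {v} {x} {y} {ws} v-x v-y (π@record { walk = w ; starts = head ; ends = ℓ } , clear) u 3≤
      with chordal (v ∷ ws) (v-x , w) (All.map (Clear⇒≢ v-x v-y) clear ∷ u) (s≤s 3≤) closing
      where
        closing : ∀ (f l : Fin (length (v ∷ ws))) → toℕ f ≡ 0 → suc (toℕ l) ≡ length (v ∷ ws) →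
                  Adj G (lookup (v ∷ ws) f) (lookup (v ∷ ws) l)
        closing zero l _ l-last = subst (Adj G v) (sym (lookup-Last (v ∷ ℓ) l l-last)) v-y
    ... | a , b , 2+a≤b , not-closing , a-b with lookup-split₂ (v ∷ ws) a b (≤-trans (n≤1+n _) 2+a≤b)
    ... | _ , [] , _ , _ , _ , b≡a+1 , _ =
      ⊥-elim (1+n≰n (subst (2 + toℕ a ≤_) (trans b≡a+1 (+-comm (toℕ a) 1)) 2+a≤b))
    ... | [] , _ ∷ _ , [] , _ , a≡0 , _ , |c|≡ =
      ⊥-elim (not-closing (sym a≡0 , trans (sym (+-identityʳ _)) (sym |c|≡)))
    ... | _ ∷ pre , m ∷ ms , post , c≡ , _ =
      subst (Shortcut x y) (sym (∷-injectiveʳ c≡))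
        (shortcut-chord pre _ m ms _ post a-b (subst (PathBetween x y) (∷-injectiveʳ c≡) π))
    ... | [] , m ∷ ms , o ∷ os , c≡ , _ =
      ⊥-elim (interior-not-adjacent ms o os (∷-injectiveʳ c≡) π u clear
                (subst (λ t → Adj G t _) (sym (∷-injectiveˡ c≡)) a-b))

    detour-step : ∀ {v x y ws} → Adj G v x → Adj G v y → Detour v x y ws → (x ≡ y ⊎ Adj G x y) ⊎ Shortcut x y ws
    detour-step {ws = ws} v-x v-y d@(π , _) with unique-or-repeat Fin._≟_ ws
    ... | inj₂ (pre , u , mid , post , refl) = inj₂ (shortcut-repeat pre u mid post π)
    ... | inj₁ unique with π
    ...   | record { starts = head ; ends = [-] }                      = inj₁ (inj₁ refl)
    ...   | record { walk = x-y , _ ; starts = head ; ends = _ ∷ [-] } = inj₁ (inj₂ x-y)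
    ...   | record { starts = head ; ends = _ ∷ _ ∷ ℓ }                =
      inj₂ (chord-shortcut v-x v-y d unique (s≤s (s≤s (∈-length (Last⇒∈ ℓ)))))

    detour-closes : ∀ {v x y ws} → Adj G v x → Adj G v y → Detour v x y ws → x ≡ y ⊎ Adj G x y
    detour-closes {v} {x} {y} {ws} v-x v-y = go ws (<-wellFounded (length ws))
      where
        go : ∀ ws → Acc _<_ (length ws) → Detour v x y ws → x ≡ y ⊎ Adj G x y
        go ws (acc shorter) d with detour-step v-x v-y d
        ... | inj₁ closed = closed
        ... | inj₂ s      = go (Shortcut.path s) (shorter (Shortcut.shorter s)) (detour-shortcut d s)

  module OnPath (chordal : Chordal G) (r₀ : V G) (rs : List (V G))
                (r-path : IsPath G (r₀ ∷ rs)) (r-unique : Unique (r₀ ∷ rs)) where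

    r : List (V G)
    r = r₀ ∷ rs

    at : ℕ → V G
    at = nth r₀ r

    H : V G → V G → Set
    H = AdjMinus G r

    _~_ : V G → V G → Set
    _~_ = Star H

    at-injective : ∀ {k l} → k < length r → l < length r → at k ≡ at l → k ≡ l
    at-injective = nth-injective r₀ r-unique

    at-≢ : ∀ {k l} → k < l → l < length r → at l ≢ at k
    at-≢ k<l l< eq = >⇒≢ k<l (at-injective l< (<-trans k<l l<) eq)

    r-step : ∀ {k} → suc k < length r → Adj G (at k) (at (suc k))
    r-step = walk-step r₀ r r-path

    r-edge-neighbour : ∀ {s w} → s < length r → EdgeOf G r (at s) w →
                       w ≡ at (suc s) ⊎ ∃ λ s′ → s ≡ suc s′ × w ≡ at s′
    r-edge-neighbour s< e with EdgeOf⇒consecutive r₀ r e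
    ... | k , k+1< , inj₁ (k≡s , k+1≡w) with at-injective (<⇒≤ k+1<) s< k≡s
    ...   | refl = inj₁ (sym k+1≡w)
    r-edge-neighbour s< e | k , k+1< , inj₂ (k≡w , k+1≡s) with at-injective k+1< s< k+1≡s
    ...   | refl = inj₂ (k , refl , sym k≡w)

    chord-of-r : ∀ {s t} → 2 + s ≤ t → t < length r → Adj G (at s) (at t) → H (at s) (at t)
    chord-of-r {s} {t} 2+s≤t t< s-t = s-t , not-r-edge
      where
        not-r-edge : ¬ EdgeOf G r (at s) (at t)
        not-r-edge e with r-edge-neighbour (<-trans (≤-trans (n≤1+n _) 2+s≤t) t<) e
        ... | inj₁ t≡               = at-≢ 2+s≤t t< t≡
        ... | inj₂ (s′ , refl , t≡) = at-≢ (≤-trans (m≤n+m _ 2) 2+s≤t) t< t≡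

    CommonNeighbour : ℕ → ℕ → ℕ → Set
    CommonNeighbour a lo c = ∃ λ t → lo ≤ t × t ≤ c × Adj G (at (1 + a)) (at t) × Adj G (at a) (at t)

    -- Extending the detour backwards along r, from r_c down to the last neighbour of v
    -- on r, keeps it a detour around v; there detour-closes applies.
    detour⇒common-neighbour : ∀ a {lo} c {ws} → 2 + a ≤ lo → lo ≤ c → c < length r →
      Adj G (at (1 + a)) (at lo) → Detour (at (1 + a)) (at a) (at c) ws → CommonNeighbour a lo c
    detour⇒common-neighbour a zero () z≤n _ _ _
    detour⇒common-neighbour a (suc c) 2+a≤lo lo≤c c< v-lo d with Adj? (at (1 + a)) (at (suc c))
    ... | yes v-c = suc c , lo≤c , ≤-refl , v-c , x-c
      where
        2+a≤c : 2 + a ≤ suc c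
        2+a≤c = ≤-trans 2+a≤lo lo≤c
        x-c : Adj G (at a) (at (suc c))
        x-c with detour-closes chordal (Adj-sym (r-step (<-≤-trans 2+a≤c (<⇒≤ c<)))) v-c d
        ... | inj₁ a≡c = ⊥-elim (at-≢ (≤-trans (n≤1+n _) 2+a≤c) c< (sym a≡c))
        ... | inj₂ x-c = x-c
    ... | no ¬v-c with m≤n⇒m<n∨m≡n lo≤c
    ...   | inj₂ refl = ⊥-elim (¬v-c v-lo)
    ...   | inj₁ (s≤s lo≤c′) with detour⇒common-neighbour a c 2+a≤lo lo≤c′ (<⇒≤ c<) v-lo
                                  (detour-snoc d (Adj-sym (r-step c<)) (c≢v , ¬v-c))
      where
        c≢v : at (suc c) ≢ at (1 + a)
        c≢v = at-≢ (≤-trans 2+a≤lo lo≤c) c<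
    ...     | t , lo≤t , t≤c , v-t , x-t = t , lo≤t , ≤-trans t≤c (n≤1+n c) , v-t , x-t

    H-walk⇒path : ∀ {x y ws} → WalkBetween H x y ws → PathBetween x y ws
    H-walk⇒path {ws = ws} record { walk = w ; starts = s ; ends = e } =
      record { walk = walk-map proj₁ ws w ; starts = s ; ends = e }

    strong-walk : ∀ {x y} inner → IsWalkIn G H (x ∷ inner ++ y ∷ []) → WalkBetween H x y (x ∷ inner ++ y ∷ [])
    strong-walk {x} inner w = record { walk = w ; starts = head ; ends = Last-++ (x ∷ inner) [-] }

    module Separation (m : ℕ) (|r|≡ : length r ≡ 2 + m)
                      (separating : ¬ (∀ u v → u ~ v))
                      (reach-first : ∀ u → at 0 ~ u ⊎ at 1 ~ u)
                      (reach-last : ∀ u → at m ~ u ⊎ at (1 + m) ~ u) where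

      open TwoEnds (AdjMinus-sym r) reach-first using (~-sym; connected?; both-≁⇒~; connected-if-ends-connected)

      first-separated : ¬ at 0 ~ at 1
      first-separated = separating ∘ connected-if-ends-connected

      last-separated : ¬ at m ~ at (1 + m)
      last-separated = separating ∘ TwoEnds.connected-if-ends-connected (AdjMinus-sym r) reach-last

      ≤1+m⇒<|r| : ∀ {k} → k ≤ 1 + m → k < length r
      ≤1+m⇒<|r| {k} k≤ = subst (k <_) (sym |r|≡) (s≤s k≤)

      <|r|⇒≤1+m : ∀ {k} → k < length r → k ≤ 1 + m
      <|r|⇒≤1+m {k} k< = ≤-pred (subst (k <_) |r|≡ k<)

      reachable⇒clear : ∀ {k w} → suc k < length r → ¬ at k ~ at (suc k) → at k ~ w →
                        Clear (at (suc k)) (at k) (at (2 + k)) w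
      reachable⇒clear {k} {w} k+1< x≁v x~w with w Fin.≟ at k | w Fin.≟ at (2 + k)
      ... | yes w≡x | _       = inj₁ w≡x
      ... | no _    | yes w≡y = inj₂ (inj₁ w≡y)
      ... | no w≢x  | no w≢y  = inj₂ (inj₂ (w≢v , ¬v-w))
        where
          w≢v : w ≢ at (suc k)
          w≢v refl = x≁v x~w
          ¬v-w : ¬ Adj G (at (suc k)) w
          ¬v-w v-w with EdgeOf? r (at (suc k)) w
          ... | no ¬e = x≁v (x~w ◅◅ AdjMinus-sym r (v-w , ¬e) ◅ ε)
          ... | yes e with r-edge-neighbour k+1< e
          ...   | inj₁ w≡y               = w≢y w≡y
          ...   | inj₂ (_ , refl , w≡x) = w≢x w≡x

      -- Otherwise r_a reaches r_c, and the resulting detour around v gives a common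
      -- neighbour r_t of r_a and v, both joined to it by H-edges (or v ~ r_t when t = a+2).
      stays-connected : ∀ a c → 2 + a ≤ c → c < length r → ¬ at a ~ at (1 + a) →
                        at (1 + a) ~ at (2 + a) → at (1 + a) ~ at c
      stays-connected a c 2+a≤c c< x≁v v~r₂ with connected? first-separated (at (1 + a)) (at c)
      ... | yes v~c = v~c
      ... | no v≁c with star⇒walk (both-≁⇒~ first-separated x≁v (v≁c ∘ ~-sym))
      ...   | ws , π =
        ⊥-elim (x≁v (joined (detour⇒common-neighbour a c ≤-refl 2+a≤c c< (r-step 2+a<)
                                (H-walk⇒path π , All.tabulate clear))))
        where
          2+a< : 2 + a < length r
          2+a< = ≤-<-trans 2+a≤c c<
          clear : ∀ {w} → w ∈ ws → Clear (at (1 + a)) (at a) (at c) w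
          clear w∈ with walk-reach π w∈
          ... | x~w with reachable⇒clear (<⇒≤ 2+a<) x≁v x~w
          ...   | inj₁ w≡x          = inj₁ w≡x
          ...   | inj₂ (inj₁ refl)  = ⊥-elim (x≁v (x~w ◅◅ ~-sym v~r₂))
          ...   | inj₂ (inj₂ w-off) = inj₂ (inj₂ w-off)
          joined : CommonNeighbour a (2 + a) c → at a ~ at (1 + a)
          joined (t , 2+a≤t , t≤c , v-t , x-t) = (chord-of-r 2+a≤t t< x-t ◅ ε) ◅◅ ~-sym v~t
            where
              t< : t < length r
              t< = ≤-<-trans t≤c c<
              v~t : at (1 + a) ~ at t
              v~t with m≤n⇒m<n∨m≡n 2+a≤t
              ... | inj₁ 3+a≤t = chord-of-r 3+a≤t t< v-t ◅ ε
              ... | inj₂ refl  = v~r₂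

      -- By induction: were r_{k+1} ~ r_{k+2}, stays-connected would join r_m to r_{m+1}.
      separated : ∀ k → k ≤ m → ¬ at k ~ at (suc k)
      separated zero    _      = first-separated
      separated (suc k) k+1≤m v~r₂ with m≤n⇒m<n∨m≡n k+1≤m
      ... | inj₂ refl  = last-separated v~r₂
      ... | inj₁ k+2≤m = last-separated (~-sym (to m k+2≤m (n≤1+n m)) ◅◅ to (suc m) (≤-trans k+2≤m (n≤1+n m)) ≤-refl)
        where
          to : ∀ c → 2 + k ≤ c → c ≤ 1 + m → at (suc k) ~ at c
          to c 2+k≤c c≤ = stays-connected k c 2+k≤c (≤1+m⇒<|r| c≤) (separated k (≤-trans (n≤1+n k) k+1≤m)) v~r₂

      skip-adjacent : ∀ k → k < m → Adj G (at k) (at (2 + k))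
      skip-adjacent k k<m = close (star⇒walk (both-≁⇒~ first-separated x≁v (separated (suc k) k<m ∘ ~-sym)))
        where
          x≁v : ¬ at k ~ at (suc k)
          x≁v = separated k (<⇒≤ k<m)
          k+2< : 2 + k < length r
          k+2< = ≤1+m⇒<|r| (s≤s k<m)
          close : ∃ (WalkBetween H (at k) (at (2 + k))) → Adj G (at k) (at (2 + k))
          close (ws , π) with detour-closes chordal (Adj-sym (r-step (<⇒≤ k+2<))) (r-step k+2<)
                                (H-walk⇒path π , All.tabulate λ w∈ → reachable⇒clear (<⇒≤ k+2<) x≁v (walk-reach π w∈))
          ... | inj₁ x≡y = ⊥-elim (at-≢ (n≤1+n _) k+2< (sym x≡y))
          ... | inj₂ x-y = x-y

      -- With v = r_{i+1}, the strong path followed by r backwards from r_j is a detour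
      -- around v, so r_i and v have a common neighbour r_t with t ≥ i+3 joined by H-edges.
      no-long-strong-connection : ∀ i j → 3 + i ≤ j → j < length r → ¬ StronglyConnected G r (at i) (at j)
      no-long-strong-connection i j 3+i≤j j< (inner , h-walk , off-r) =
        close (detour⇒common-neighbour i j (n≤1+n _) 3+i≤j j< (skip-adjacent (suc i) 2+i≤m) (H-walk⇒path π , clear))
        where
          π : WalkBetween H (at i) (at j) (at i ∷ inner ++ at j ∷ [])
          π = strong-walk inner h-walk
          2+i≤m : 2 + i ≤ m
          2+i≤m = ≤-pred (≤-trans 3+i≤j (<|r|⇒≤1+m j<))
          x≁v : ¬ at i ~ at (suc i)
          x≁v = separated i (≤-trans (n≤1+n i) (≤-trans (n≤1+n _) 2+i≤m))
          2+i< : 2 + i < length r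
          2+i< = ≤1+m⇒<|r| (≤-trans 2+i≤m (n≤1+n m))
          inner-clear : ∀ {w} → w ∈ inner → Clear (at (suc i)) (at i) (at j) w
          inner-clear w∈ with reachable⇒clear {k = i} (<⇒≤ 2+i<) x≁v (walk-reach π (there (∈-++⁺ˡ w∈)))
          ... | inj₁ w≡x          = inj₁ w≡x
          ... | inj₂ (inj₁ refl)  = ⊥-elim (All.lookup off-r w∈ (nth-∈ r₀ r 2+i<))
          ... | inj₂ (inj₂ w-off) = inj₂ (inj₂ w-off)
          clear : All (Clear (at (suc i)) (at i) (at j)) (at i ∷ inner ++ at j ∷ [])
          clear = inj₁ refl ∷ All-++⁺ (All.tabulate inner-clear) (inj₂ (inj₁ refl) ∷ [])
          close : CommonNeighbour i (3 + i) j → ⊥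
          close (t , 3+i≤t , t≤j , v-t , x-t) =
            x≁v ((chord-of-r (≤-trans (n≤1+n _) 3+i≤t) t< x-t ◅ ε) ◅◅ ~-sym (chord-of-r 3+i≤t t< v-t ◅ ε))
            where
              t< : t < length r
              t< = ≤-<-trans t≤j j<

      strongly-connected⇒gap-2 : ∀ i j → i < j → j < length r → StronglyConnected G r (at i) (at j) → j ≡ 2 + i
      strongly-connected⇒gap-2 i j i<j j< sc@(inner , h-walk , _) with <-cmp j (2 + i)
      ... | tri≈ _ j≡2+i _ = j≡2+i
      ... | tri> _ _ 2+i<j = ⊥-elim (no-long-strong-connection i j 2+i<j j< sc)
      ... | tri< j<2+i _ _ with ≤-antisym (≤-pred j<2+i) i<j
      ...   | refl = ⊥-elim (separated i (≤-pred (<|r|⇒≤1+m j<))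
                               (walk-reach (strong-walk inner h-walk) (Last⇒∈ (Last-++ (at i ∷ inner) [-]))))

    gap-2⇒strongly-connected : ∀ i → 2 + i < length r → Adj G (at i) (at (2 + i)) →
                               StronglyConnected G r (at i) (at (2 + i))
    gap-2⇒strongly-connected i 2+i< x-y = [] , (chord-of-r ≤-refl 2+i< x-y , _) , []

  proper-subpath-connects : ∀ {r q} → IsSeparatorPath G r → Contains G r q → IsPath G q → length q < length r →
                            ¬ ¬ (∀ u v → Star (AdjMinus G q) u v)
  proper-subpath-connects (_ , _ , minimal) r⊇q q-path shorter q-connects =
    >⇒≢ shorter (sym (cong length (minimal _ r⊇q (q-path , q-connects))))

  first-edge-reach : ∀ {r₀ r₁ rest} → let r = r₀ ∷ r₁ ∷ rest in IsSeparatorPath G r →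
                     ¬ ¬ (∀ u → Star (AdjMinus G r) r₀ u ⊎ Star (AdjMinus G r) r₁ u)
  first-edge-reach {r₀} {r₁} {rest} sep@(((_ , tail-path) , _) , _) ¬reach =
    proper-subpath-connects sep ((λ ()) , r₀ ∷ [] , [] , cong (r₀ ∷_) (sym (++-identityʳ _))) tail-path ≤-refl
      λ connects → ¬reach λ u → reach-either-end (Sum.swap ∘ EdgeOf-split (r₀ ∷ [])) (connects r₀ u)

  last-edge-reach : ∀ {r} init z y → r ≡ init ++ z ∷ y ∷ [] → IsSeparatorPath G r →
                    ¬ ¬ (∀ u → Star (AdjMinus G r) z u ⊎ Star (AdjMinus G r) y u)
  last-edge-reach init z y refl sep@((r-path , _) , _) ¬reach =
    proper-subpath-connects sep (nonempty init , [] , y ∷ [] , sym (++-assoc init (z ∷ []) (y ∷ [])))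
      (walk-prefix init r-path) (length-++-< init ≤-refl)
      λ connects → ¬reach λ u → reach-either-end (EdgeOf-split init) (connects z u)
    where
      nonempty : ∀ xs → xs ++ z ∷ [] ≢ []
      nonempty []      ()
      nonempty (_ ∷ _) ()

  strongly-connected⇔gap-2 : Chordal G → ∀ {r₀ r₁ rest} → let r = r₀ ∷ r₁ ∷ rest in IsSeparatorPath G r →
    ∀ i j → i < j → j < length r → StronglyConnected G r (nth r₀ r i) (nth r₀ r j) ⇔ (j ≡ 2 + i)
  strongly-connected⇔gap-2 chordal {r₀} {r₁} {rest} sep@((r-path , r-unique) , (_ , separating) , _) i j i<j j<
    with split-last-two r₀ r₁ rest
  ... | init , z , y , r≡ = mk⇔
    (λ sc → stable (j ≟ 2 + i) λ reach₁ reach₂ → S.strongly-connected⇒gap-2 reach₁ reach₂ i j i<j j< sc)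
    (λ { refl → gap-2⇒strongly-connected i j<
                  (stable (Adj? _ _) λ reach₁ reach₂ → S.skip-adjacent reach₁ reach₂ i (≤-pred (≤-pred (subst (2 + i <_) |r|≡ j<)))) })
    where
      open OnPath chordal r₀ (r₁ ∷ rest) r-path r-unique
      m : ℕ
      m = length init
      |r|≡ : length r ≡ 2 + m
      |r|≡ = trans (cong length r≡) (trans (length-++ init) (+-comm m 2))
      at-m : at m ≡ z
      at-m = trans (cong (λ l → nth r₀ l m) r≡) (nth-++ r₀ init 0)
      at-1+m : at (1 + m) ≡ y
      at-1+m = trans (cong (λ l → nth r₀ l (1 + m)) r≡) (nth-++ r₀ init 1)
      Reach : V G → V G → Set
      Reach e₁ e₂ = ∀ u → e₁ ~ u ⊎ e₂ ~ u
      module S (reach₁ : Reach (at 0) (at 1)) (reach₂ : Reach z y) =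
        Separation m |r|≡ separating reach₁ (subst₂ Reach (sym at-m) (sym at-1+m) reach₂)
      -- Minimality of r yields the two reachability facts only under a double negation,
      -- which is harmless as both goals are decidable.
      stable : ∀ {P : Set} → Dec P → (Reach (at 0) (at 1) → Reach z y → P) → P
      stable P? k = decidable-stable P? λ ¬p →
        first-edge-reach sep λ reach₁ → last-edge-reach init z y r≡ sep λ reach₂ → ¬p (k reach₁ reach₂)

theorem9 : (G : Graph) → Connected G → Chordal G →
    (r : List (V G)) → IsSeparatorPath G r →
    (i j : Fin (length r)) → toℕ i < toℕ j →
    StronglyConnected G r (lookup r i) (lookup r j) ⇔ (toℕ j ≡ toℕ i + 2)
theorem9 G _         _       []       ((() , _) , _)
theorem9 G connected _       (_ ∷ []) (_ , (_ , separating) , _) =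
  ⊥-elim (separating λ u v → Star.map (λ uv → uv , λ ()) (connected u v))
theorem9 G _         chordal r@(r₀ ∷ _ ∷ _) sep i j i<j =
  subst₂ (λ a b → StronglyConnected G r a b ⇔ (toℕ j ≡ toℕ i + 2)) (sym (lookup≡nth r₀ r i)) (sym (lookup≡nth r₀ r j))
    (subst (λ k → StronglyConnected G r (nth r₀ r (toℕ i)) (nth r₀ r (toℕ j)) ⇔ (toℕ j ≡ k)) (+-comm 2 (toℕ i))
      (strongly-connected⇔gap-2 G chordal sep (toℕ i) (toℕ j) i<j (toℕ<n j)))
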